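{- A cirquent is provable in $\mathbf{CCC}$ iff it is a tautology.
   Context: Formulas are built from infinitely many propositional atoms using $\neg$ (applied only to atoms; $\neg\neg F$ abbreviates $F$, and $\neg$ of a compound formula is understood via De Morgan's laws), $\wedge$ and $\vee$. A $k$-ary cirquent is a pair consisting of a pool, i.e. a sequence $\langle F_1,\ldots,F_k\rangle$ of formulas (their occurrences are called oformulas), and a structure, i.e. a finite sequence of groups, each group being a subset of $\{1,\ldots,k\}$, thought of as the set of oformulas it contains (occurrences of groups are called ogroups). A formula $F$ is identified with the cirquent with pool $\langle F\rangle$ and structure $\langle\{1\}\rangle$. A classical model assigns a truth value to each atom and extends to formulas in the standard way. A group of a cirquent is true in a model iff at least one of its oformulas is true; a cirquent is true in a model iff all of its groups are true; a cirquent is a tautology iff it is true in every model. $\mathbf{CCC}$ is the cirquent calculus system with the following eight rules, and a proof of a cirquent is a tree of cirquents with that cirquent at the root, each node following from its children by a rule (leaves being axioms). (Axioms) the empty cirquent (empty pool and empty structure), and the identity axiom: pool $\langle\neg F,F\rangle$, structure $\langle\{1,2\}\rangle$. (Mix) from two premises, the conclusion places one next to the other (concatenating pools and structures). (Exchange) swap two adjacent oformulas, correspondingly redirecting group membership, or swap two adjacent ogroups. (Weakening) add an existing oformula to an existing ogroup, or insert a new oformula anywhere in the pool (belonging to no group). (Duplication) downward: replace an ogroup by two adjacent ogroups identical to it as groups; upward: the converse. (Contraction) merge two adjacent oformulas that are the same formula $F$ into one oformula $F$, every ogroup that contained either of them now containing the merged one. ($\vee$-introduction) merge two adjacent oformulas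 $F,G$ into one oformula $F\vee G$, so that an ogroup of the conclusion contains $F\vee G$ iff the corresponding ogroup of the premise contains at least one of $F,G$. ($\wedge$-introduction) the premise has adjacent oformulas $F,G$ such that no ogroup contains both, every ogroup containing $F$ is immediately followed by an ogroup containing $G$, and every ogroup containing $G$ is immediately preceded by an ogroup containing $F$; the conclusion merges each ogroup containing $F$ with the immediately following ogroup (taking the union), and then merges $F$ and $G$ into the single oformula $F\wedge G$. -}

module Defs where

open import Data.Nat using (ℕ; zero; suc; _+_)
open import Data.Bool using (Bool; true; false; not; _∧_; _∨_)
open import Data.Fin using (Fin; toℕ)
open import Data.Vec using (Vec; []; _∷_; _++_; replicate; zipWith; lookup; _[_]≔_)
open import Data.List using (List; []; _∷_; map; length) renaming (_++_ to _++ᴸ_; lookup to lookupᴸ)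
open import Data.List.Relation.Unary.All using (All)
open import Data.Product using (Σ; _×_; ∃)
open import Relation.Binary.PropositionalEquality using (_≡_)
open import Relation.Nullary using (¬_)

data Formula : Set where
  atom  : ℕ → Formula
  natom : ℕ → Formula
  _⋀_   : Formula → Formula → Formula
  _⋁_   : Formula → Formula → Formula

neg : Formula → Formula
neg (atom a)  = natom a
neg (natom a) = atom a
neg (F ⋀ G)   = neg F ⋁ neg G
neg (F ⋁ G)   = neg F ⋀ neg G

-- Cirquents: a k-ary pool and a structure (finite sequence of groups,
-- each group a subset of {1..k} given by its characteristic vector).

Group : ℕ → Set
Group k = Vec Bool k

record Cirquent : Set where
  constructor cirquent
  field
    arity  : ℕ
    pool   : Vec Formula arity
    struct : List (Group arity)

open Cirquent public

Model : Set
Model = ℕ → Bool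

eval : Model → Formula → Bool
eval v (atom a)  = v a
eval v (natom a) = not (v a)
eval v (F ⋀ G)   = eval v F ∧ eval v G
eval v (F ⋁ G)   = eval v F ∨ eval v G

GroupTrue : ∀ {k} → Model → Vec Formula k → Group k → Set
GroupTrue {k} v p g = Σ (Fin k) λ i → (lookup g i ≡ true) × (eval v (lookup p i) ≡ true)

CirquentTrue : Model → Cirquent → Set
CirquentTrue v (cirquent k p s) = All (GroupTrue v p) s

Tautology : Cirquent → Set
Tautology C = (v : Model) → CirquentTrue v C

-- Auxiliary operations on groups, for adjacent oformulas at positions
-- m and m+1 (0-based) of a pool of length m + 2 + n.

pairAt : ∀ {n} (m : ℕ) → Group (m + suc (suc n)) → Bool × Bool
pairAt zero    (b ∷ c ∷ _) = Data.Product._,_ b c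
pairAt (suc m) (_ ∷ g)     = pairAt m g

inF inG : ∀ {n} (m : ℕ) → Group (m + suc (suc n)) → Bool
inF m g = Data.Product.proj₁ (pairAt m g)
inG m g = Data.Product.proj₂ (pairAt m g)

mergeAt : ∀ {n} (m : ℕ) → Group (m + suc (suc n)) → Group (m + suc n)
mergeAt zero    (b ∷ c ∷ g) = (b ∨ c) ∷ g
mergeAt (suc m) (x ∷ g)     = x ∷ mergeAt m g

swapAt : ∀ {n} (m : ℕ) → Group (m + suc (suc n)) → Group (m + suc (suc n))
swapAt zero    (b ∷ c ∷ g) = c ∷ b ∷ g
swapAt (suc m) (x ∷ g)     = x ∷ swapAt m g

insertAt : ∀ {n} (m : ℕ) → Group (m + n) → Group (m + suc n)
insertAt zero    g       = false ∷ g
insertAt (suc m) (x ∷ g) = x ∷ insertAt m g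

-- ∧-introduction on the structure: each ogroup containing F is merged
-- (union) with the immediately following ogroup; then F,G are merged.
andMerge : ∀ {n} (m : ℕ) → List (Group (m + suc (suc n))) → List (Group (m + suc n))
andMergeAux : ∀ {n} (m : ℕ) → Bool → Group (m + suc (suc n)) →
              List (Group (m + suc (suc n))) → List (Group (m + suc n))
andMerge m [] = []
andMerge m (g ∷ gs) = andMergeAux m (inF m g) g gs
andMergeAux m true  g (h ∷ gs) = mergeAt m (zipWith _∨_ g h) ∷ andMerge m gs
andMergeAux m true  g []       = mergeAt m g ∷ []
andMergeAux m false g gs       = mergeAt m g ∷ andMerge m gs

AndOK : ∀ {n} (m : ℕ) → List (Group (m + suc (suc n))) → Set
AndOK m gs =
    ((i : Fin (length gs)) → ¬ ((inF m (lookupᴸ gs i) ≡ true) × (inG m (lookupᴸ gs i) ≡ true)))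
  × ((i : Fin (length gs)) → inF m (lookupᴸ gs i) ≡ true →
       Σ (Fin (length gs)) λ j → (toℕ j ≡ suc (toℕ i)) × (inG m (lookupᴸ gs j) ≡ true))
  × ((j : Fin (length gs)) → inG m (lookupᴸ gs j) ≡ true →
       Σ (Fin (length gs)) λ i → (toℕ j ≡ suc (toℕ i)) × (inF m (lookupᴸ gs i) ≡ true))

data Proof : Cirquent → Set where
  ax-empty : Proof (cirquent 0 [] [])
  ax-id    : (F : Formula) →
             Proof (cirquent 2 (neg F ∷ F ∷ []) ((true ∷ true ∷ []) ∷ []))
  mix : ∀ {k₁ k₂} {p₁ : Vec Formula k₁} {p₂ : Vec Formula k₂} {s₁ s₂} →
        Proof (cirquent k₁ p₁ s₁) → Proof (cirquent k₂ p₂ s₂) →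
        Proof (cirquent (k₁ + k₂) (p₁ ++ p₂)
                 (map (λ g → g ++ replicate k₂ false) s₁ ++ᴸ map (λ g → replicate k₁ false ++ g) s₂))
  exch-formula : ∀ {m n} (xs : Vec Formula m) (F G : Formula) (ys : Vec Formula n) s →
        Proof (cirquent (m + suc (suc n)) (xs ++ F ∷ G ∷ ys) s) →
        Proof (cirquent (m + suc (suc n)) (xs ++ G ∷ F ∷ ys) (map (swapAt m) s))
  exch-group : ∀ {k} (p : Vec Formula k) (gs : List (Group k)) (g h : Group k) hs →
        Proof (cirquent k p (gs ++ᴸ g ∷ h ∷ hs)) →
        Proof (cirquent k p (gs ++ᴸ h ∷ g ∷ hs))
  weak-group : ∀ {k} (p : Vec Formula k) (gs : List (Group k)) (g : Group k) hs (i : Fin k) →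
        Proof (cirquent k p (gs ++ᴸ g ∷ hs)) →
        Proof (cirquent k p (gs ++ᴸ (g [ i ]≔ true) ∷ hs))
  weak-pool : ∀ {m n} (xs : Vec Formula m) (F : Formula) (ys : Vec Formula n) s →
        Proof (cirquent (m + n) (xs ++ ys) s) →
        Proof (cirquent (m + suc n) (xs ++ F ∷ ys) (map (insertAt m) s))
  dup-down : ∀ {k} (p : Vec Formula k) (gs : List (Group k)) (g : Group k) hs →
        Proof (cirquent k p (gs ++ᴸ g ∷ hs)) →
        Proof (cirquent k p (gs ++ᴸ g ∷ g ∷ hs))
  dup-up : ∀ {k} (p : Vec Formula k) (gs : List (Group k)) (g : Group k) hs →
        Proof (cirquent k p (gs ++ᴸ g ∷ g ∷ hs)) →
        Proof (cirquent k p (gs ++ᴸ g ∷ hs))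
  contr : ∀ {m n} (xs : Vec Formula m) (F : Formula) (ys : Vec Formula n) s →
        Proof (cirquent (m + suc (suc n)) (xs ++ F ∷ F ∷ ys) s) →
        Proof (cirquent (m + suc n) (xs ++ F ∷ ys) (map (mergeAt m) s))
  or-intro : ∀ {m n} (xs : Vec Formula m) (F G : Formula) (ys : Vec Formula n) s →
        Proof (cirquent (m + suc (suc n)) (xs ++ F ∷ G ∷ ys) s) →
        Proof (cirquent (m + suc n) (xs ++ (F ⋁ G) ∷ ys) (map (mergeAt m) s))
  and-intro : ∀ {m n} (xs : Vec Formula m) (F G : Formula) (ys : Vec Formula n) s →
        AndOK m s →
        Proof (cirquent (m + suc (suc n)) (xs ++ F ∷ G ∷ ys) s) →
        Proof (cirquent (m + suc n) (xs ++ (F ⋀ G) ∷ ys) (andMerge m s))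

Provable : Cirquent → Set
Provable C = Proof C

{-# OPTIONS --safe #-}
module Submission where

-- Soundness: every rule carries a true member of each premise group to a true
-- member of the corresponding conclusion group.  The side condition of
-- ∧-introduction says that the structure consists of blocks [group with F,
-- group with G] and of groups containing neither; if both groups of a block
-- are true, then either F and G are both true or one of the true members
-- survives the merge.
--
-- Completeness: two proofs over the same pool combine into a proof of the
-- concatenated structure (mix them, then contract every oformula with its
-- copy), so it suffices to derive a single tautological group.  A compound
-- member is removed by ∨- or ∧-introduction (the ∧ case yields two groups,
-- combined again), by induction on the number of connectives in the pool.
-- Once all members are literals, the group contains some p and ¬p, and it
-- follows from an identity axiom by weakening.

open import Defs
open import Data.Bool using (Bool; true; false; not; _∧_; _∨_)
open import Data.Bool.Properties
  using (not-involutive; ∨-zeroʳ; ∨-identityʳ; ∨-idem; ∧-zeroʳ; ∨-∧-booleanAlgebra)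
open import Algebra.Lattice.Properties.BooleanAlgebra ∨-∧-booleanAlgebra using (deMorgan₁; deMorgan₂)
open import Data.Empty using (⊥-elim)
open import Data.Fin using (Fin; toℕ; _↑ʳ_) renaming (zero to fzero; suc to fsuc)
open import Data.List using (List; []; _∷_; _++_; length; map; replicate; zipWith)
  renaming (lookup to lookupᴸ)
open import Data.List.Properties
  using (map-∘; map-cong; map-cong-local; map-++; map-id; map-id-local; map-injective;
         ++-assoc; length-++; length-replicate)
open import Data.List.Relation.Unary.All using (All; []; _∷_; universal)
import Data.List.Relation.Unary.All as All
open import Data.List.Relation.Unary.All.Properties using (++⁺; ++⁻; map⁺)
open import Data.Nat using (ℕ; zero; suc; _+_; _<_; s≤s; _≟_)
open import Data.Nat.Induction using (<-wellFounded)
open import Data.Nat.ListAction using (sum)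
open import Data.Nat.Properties using (suc-injective; +-comm; +-assoc; +-monoʳ-<; ≤-reflexive)
open import Data.Product using (Σ; ∃-syntax; _×_; _,_; proj₁; proj₂; map₁; map₂)
open import Data.Vec as Vec using (Vec; []; _∷_; toList; fromList; _[_]≔_) renaming (_++_ to _++ᵛ_)
open import Data.Vec.Properties
  using (toList-injective; toList-++; toList-replicate; length-toList; toList∘fromList;
         zipWith-++; zipWith-idem; []≔-++-↑ʳ)
open import Data.Vec.Relation.Binary.Equality.Cast using (cast-is-id)
open import Function using (_∘_; id)
open import Induction.WellFounded using (Acc; acc)
open import Relation.Binary.PropositionalEquality
open import Relation.Nullary using (¬_; Dec; does; yes; no)
open import Relation.Nullary.Decidable using (map′)

private variable
  T : Set
  k m n : ℕ
  F G H : Formula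

false≢true : false ≢ true
false≢true ()

data Member (F : Formula) : List Formula → List Bool → Set where
  here  : ∀ {P g} → Member F (F ∷ P) (true ∷ g)
  there : ∀ {H b P g} → Member F P g → Member F (H ∷ P) (b ∷ g)

Holds : Model → List Formula → List Bool → Set
Holds v P g = ∃[ F ] Member F P g × eval v F ≡ true

Holdsᵛ : Model → Vec Formula k → Group k → Set
Holdsᵛ v p g = Holds v (toList p) (toList g)

Holds-map : ∀ {v P g P′ g′} → (∀ {F} → Member F P g → Member F P′ g′) →
            Holds v P g → Holds v P′ g′
Holds-map f = map₂ (map₁ f)

Holds-there : ∀ {v P g b} → Holds v P g → Holds v (H ∷ P) (b ∷ g)
Holds-there = Holds-map there

GroupTrue⇒Holds : ∀ v (p : Vec Formula k) (g : Group k) → GroupTrue v p g → Holdsᵛ v p g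
GroupTrue⇒Holds v (F ∷ p) (_ ∷ g) (fzero , refl , e) = F , here , e
GroupTrue⇒Holds v (F ∷ p) (_ ∷ g) (fsuc i , e)       = Holds-there (GroupTrue⇒Holds v p g (i , e))

Holds⇒GroupTrue : ∀ v (p : Vec Formula k) (g : Group k) → Holdsᵛ v p g → GroupTrue v p g
Holds⇒GroupTrue v (F ∷ p) (_ ∷ g) (_ , here , e)    = fzero , refl , e
Holds⇒GroupTrue v (F ∷ p) (_ ∷ g) (K , there m , e) with Holds⇒GroupTrue v p g (K , m , e)
... | i , e′ = fsuc i , e′

eval-neg : ∀ v F → eval v (neg F) ≡ not (eval v F)
eval-neg v (atom a)  = refl
eval-neg v (natom a) = sym (not-involutive (v a))
eval-neg v (F ⋀ G)   =
  trans (cong₂ _∨_ (eval-neg v F) (eval-neg v G)) (sym (deMorgan₁ (eval v F) (eval v G)))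
eval-neg v (F ⋁ G)   =
  trans (cong₂ _∧_ (eval-neg v F) (eval-neg v G)) (sym (deMorgan₂ (eval v F) (eval v G)))

-- Soundness

identity-holds : ∀ v F → Holds v (neg F ∷ F ∷ []) (true ∷ true ∷ [])
identity-holds v F with eval v F in e
... | true  = F , there here , e
... | false = neg F , here , trans (eval-neg v F) (cong not e)

Member-padʳ : ∀ {k₁ k₂} (p₁ : Vec Formula k₁) (p₂ : Vec Formula k₂) (g : Group k₁) →
              Member F (toList p₁) (toList g) →
              Member F (toList (p₁ ++ᵛ p₂)) (toList (g ++ᵛ Vec.replicate k₂ false))
Member-padʳ (_ ∷ p₁) p₂ (_ ∷ g) here      = here
Member-padʳ (_ ∷ p₁) p₂ (_ ∷ g) (there m) = there (Member-padʳ p₁ p₂ g m)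

Member-padˡ : ∀ {k₁ k₂} (p₁ : Vec Formula k₁) (p₂ : Vec Formula k₂) (g : Group k₂) →
              Member F (toList p₂) (toList g) →
              Member F (toList (p₁ ++ᵛ p₂)) (toList (Vec.replicate k₁ false ++ᵛ g))
Member-padˡ []       p₂ g m = m
Member-padˡ (_ ∷ p₁) p₂ g m = there (Member-padˡ p₁ p₂ g m)

Member-swap : ∀ (xs : Vec Formula m) F G (ys : Vec Formula n) (g : Group (m + suc (suc n))) →
              Member H (toList (xs ++ᵛ F ∷ G ∷ ys)) (toList g) →
              Member H (toList (xs ++ᵛ G ∷ F ∷ ys)) (toList (swapAt m g))
Member-swap []       F G ys (_ ∷ _ ∷ g) here              = there here
Member-swap []       F G ys (_ ∷ _ ∷ g) (there here)      = here
Member-swap []       F G ys (_ ∷ _ ∷ g) (there (there m)) = there (there m)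
Member-swap (_ ∷ xs) F G ys (_ ∷ g)     here              = here
Member-swap (_ ∷ xs) F G ys (_ ∷ g)     (there m)         = there (Member-swap xs F G ys g m)

Member-insert : ∀ (xs : Vec Formula m) F (ys : Vec Formula n) (g : Group (m + n)) →
                Member H (toList (xs ++ᵛ ys)) (toList g) →
                Member H (toList (xs ++ᵛ F ∷ ys)) (toList (insertAt m g))
Member-insert []       F ys g       m         = there m
Member-insert (_ ∷ xs) F ys (_ ∷ g) here      = here
Member-insert (_ ∷ xs) F ys (_ ∷ g) (there m) = there (Member-insert xs F ys g m)

Member-set : ∀ (p : Vec Formula k) (g : Group k) i →
             Member H (toList p) (toList g) → Member H (toList p) (toList (g [ i ]≔ true))
Member-set (_ ∷ p) (_ ∷ g) fzero    here      = here
Member-set (_ ∷ p) (_ ∷ g) fzero    (there m) = there m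
Member-set (_ ∷ p) (_ ∷ g) (fsuc i) here      = here
Member-set (_ ∷ p) (_ ∷ g) (fsuc i) (there m) = there (Member-set p g i m)

Member-zipˡ : ∀ (p : Vec Formula k) (g h : Group k) →
              Member F (toList p) (toList g) → Member F (toList p) (toList (Vec.zipWith _∨_ g h))
Member-zipˡ (_ ∷ p) (_ ∷ g) (_ ∷ h) here      = here
Member-zipˡ (_ ∷ p) (_ ∷ g) (_ ∷ h) (there m) = there (Member-zipˡ p g h m)

Member-zipʳ : ∀ (p : Vec Formula k) (g h : Group k) →
              Member F (toList p) (toList h) → Member F (toList p) (toList (Vec.zipWith _∨_ g h))
Member-zipʳ (_ ∷ p) (true  ∷ g) (_ ∷ h) here      = here
Member-zipʳ (_ ∷ p) (false ∷ g) (_ ∷ h) here      = here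
Member-zipʳ (_ ∷ p) (_     ∷ g) (_ ∷ h) (there m) = there (Member-zipʳ p g h m)

Holds-merge : ∀ {v} (xs : Vec Formula m) F G H (ys : Vec Formula n) (g : Group (m + suc (suc n))) →
              (inF m g ≡ true → eval v F ≡ true → eval v H ≡ true) →
              (inG m g ≡ true → eval v G ≡ true → eval v H ≡ true) →
              Holdsᵛ v (xs ++ᵛ F ∷ G ∷ ys) g → Holdsᵛ v (xs ++ᵛ H ∷ ys) (mergeAt m g)
Holds-merge []       F G H ys (true  ∷ _    ∷ g) F⇒H G⇒H (_ , here , e)            = H , here , F⇒H refl e
Holds-merge []       F G H ys (true  ∷ true ∷ g) F⇒H G⇒H (_ , there here , e)      = H , here , G⇒H refl e
Holds-merge []       F G H ys (false ∷ true ∷ g) F⇒H G⇒H (_ , there here , e)      = H , here , G⇒H refl e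
Holds-merge []       F G H ys (_ ∷ _ ∷ g)        F⇒H G⇒H (K , there (there m) , e) = K , there m , e
Holds-merge (x ∷ xs) F G H ys (_ ∷ g)            F⇒H G⇒H (_ , here , e)            = x , here , e
Holds-merge (x ∷ xs) F G H ys (_ ∷ g)            F⇒H G⇒H (K , there m , e)         =
  Holds-there (Holds-merge xs F G H ys g F⇒H G⇒H (K , m , e))

Holds-∧-pair : ∀ {v} (xs : Vec Formula m) F G (ys : Vec Formula n) (g h : Group (m + suc (suc n))) →
               pairAt m g ≡ (true , false) → pairAt m h ≡ (false , true) →
               Holdsᵛ v (xs ++ᵛ F ∷ G ∷ ys) g → Holdsᵛ v (xs ++ᵛ F ∷ G ∷ ys) h →
               Holdsᵛ v (xs ++ᵛ (F ⋀ G) ∷ ys) (mergeAt m (Vec.zipWith _∨_ g h))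
Holds-∧-pair [] F G ys (_ ∷ _ ∷ g) (_ ∷ _ ∷ h) refl refl (K , there (there m) , e) _ =
  K , there (Member-zipˡ ys g h m) , e
Holds-∧-pair [] F G ys (_ ∷ _ ∷ g) (_ ∷ _ ∷ h) refl refl _ (K , there (there m) , e) =
  K , there (Member-zipʳ ys g h m) , e
Holds-∧-pair [] F G ys (_ ∷ _ ∷ g) (_ ∷ _ ∷ h) refl refl (_ , here , eF) (_ , there here , eG) =
  F ⋀ G , here , cong₂ _∧_ eF eG
Holds-∧-pair (x ∷ xs) F G ys (true  ∷ g) (_ ∷ h) _ _ (_ , here , e) _ = x , here , e
Holds-∧-pair (x ∷ xs) F G ys (true  ∷ g) (_ ∷ h) _ _ _ (_ , here , e) = x , here , e
Holds-∧-pair (x ∷ xs) F G ys (false ∷ g) (_ ∷ h) _ _ _ (_ , here , e) = x , here , e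
Holds-∧-pair (x ∷ xs) F G ys (_ ∷ g) (_ ∷ h) eg eh (K , there m , e) (K′ , there m′ , e′) =
  Holds-there (Holds-∧-pair xs F G ys g h eg eh (K , m , e) (K′ , m′ , e′))

data Paired {n} (m : ℕ) : List (Group (m + suc (suc n))) → Set where
  []   : Paired m []
  skip : ∀ {g s} → pairAt m g ≡ (false , false) → Paired m s → Paired m (g ∷ s)
  pair : ∀ {g h s} → pairAt m g ≡ (true , false) → pairAt m h ≡ (false , true) →
         Paired m s → Paired m (g ∷ h ∷ s)

AndOK-tail : ∀ {g} {s : List (Group (m + suc (suc n)))} → inF m g ≡ false →
             AndOK m (g ∷ s) → AndOK m s
AndOK-tail {m = m} {s = s} F∉g (disjoint , followed , preceded) =
  disjoint ∘ fsuc , followed′ , preceded′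
  where
  followed′ : (i : Fin (length s)) → inF m (lookupᴸ s i) ≡ true →
              Σ (Fin (length s)) λ j → toℕ j ≡ suc (toℕ i) × inG m (lookupᴸ s j) ≡ true
  followed′ i F∈ with followed (fsuc i) F∈
  ... | fsuc j , e , G∈ = j , suc-injective e , G∈
  preceded′ : (j : Fin (length s)) → inG m (lookupᴸ s j) ≡ true →
              Σ (Fin (length s)) λ i → toℕ j ≡ suc (toℕ i) × inF m (lookupᴸ s i) ≡ true
  preceded′ j G∈ with preceded (fsuc j) G∈
  ... | fzero  , _ , F∈g = ⊥-elim (false≢true (trans (sym F∉g) F∈g))
  ... | fsuc i , e , F∈  = i , suc-injective e , F∈

AndOK-tail₂ : ∀ {g h} {s : List (Group (m + suc (suc n)))} → inF m h ≡ false →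
              AndOK m (g ∷ h ∷ s) → AndOK m s
AndOK-tail₂ {m = m} {s = s} F∉h (disjoint , followed , preceded) =
  disjoint ∘ fsuc ∘ fsuc , followed′ , preceded′
  where
  followed′ : (i : Fin (length s)) → inF m (lookupᴸ s i) ≡ true →
              Σ (Fin (length s)) λ j → toℕ j ≡ suc (toℕ i) × inG m (lookupᴸ s j) ≡ true
  followed′ i F∈ with followed (fsuc (fsuc i)) F∈
  ... | fsuc (fsuc j) , e , G∈ = j , suc-injective (suc-injective e) , G∈
  preceded′ : (j : Fin (length s)) → inG m (lookupᴸ s j) ≡ true →
              Σ (Fin (length s)) λ i → toℕ j ≡ suc (toℕ i) × inF m (lookupᴸ s i) ≡ true
  preceded′ j G∈ with preceded (fsuc (fsuc j)) G∈
  ... | fsuc fzero     , _ , F∈h = ⊥-elim (false≢true (trans (sym F∉h) F∈h))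
  ... | fsuc (fsuc i) , e , F∈  = i , suc-injective (suc-injective e) , F∈

AndOK⇒Paired : ∀ (s : List (Group (m + suc (suc n)))) → AndOK m s → Paired m s
AndOK⇒Paired [] _ = []
AndOK⇒Paired {m} (g ∷ s) ok@(disjoint , followed , preceded) with pairAt m g in eg
... | true , true = ⊥-elim (disjoint fzero (cong proj₁ eg , cong proj₂ eg))
... | false , true with preceded fzero (cong proj₂ eg)
...   | _ , () , _
AndOK⇒Paired {m} (g ∷ s) ok | false , false =
  skip eg (AndOK⇒Paired s (AndOK-tail {g = g} (cong proj₁ eg) ok))
AndOK⇒Paired {m} (g ∷ []) ok@(_ , followed , _) | true , false with followed fzero (cong proj₁ eg)
... | fzero , () , _
AndOK⇒Paired {m} (g ∷ h ∷ s) ok@(disjoint , followed , _) | true , false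
  with followed fzero (cong proj₁ eg) | pairAt m h in eh
... | fsuc fzero , _ , G∈h | true , _      = ⊥-elim (disjoint (fsuc fzero) (cong proj₁ eh , G∈h))
... | fsuc fzero , _ , G∈h | false , false = ⊥-elim (false≢true (trans (sym (cong proj₂ eh)) G∈h))
... | fsuc fzero , _ , _   | false , true  =
  pair eg eh (AndOK⇒Paired s (AndOK-tail₂ {g = g} {h} (cong proj₁ eh) ok))

Holds-andMerge : ∀ {v} (xs : Vec Formula m) F G (ys : Vec Formula n) {s} → Paired m s →
                 All (Holdsᵛ v (xs ++ᵛ F ∷ G ∷ ys)) s →
                 All (Holdsᵛ v (xs ++ᵛ (F ⋀ G) ∷ ys)) (andMerge m s)
Holds-andMerge xs F G ys [] [] = []
Holds-andMerge xs F G ys (skip {g} eg ps) (t ∷ ts) rewrite cong proj₁ eg =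
  Holds-merge xs F G (F ⋀ G) ys g (λ F∈ → ⊥-elim (false≢true (trans (sym (cong proj₁ eg)) F∈)))
                                  (λ G∈ → ⊥-elim (false≢true (trans (sym (cong proj₂ eg)) G∈))) t
  ∷ Holds-andMerge xs F G ys ps ts
Holds-andMerge xs F G ys (pair {g} {h} eg eh ps) (tg ∷ th ∷ ts) rewrite cong proj₁ eg =
  Holds-∧-pair xs F G ys g h eg eh tg th ∷ Holds-andMerge xs F G ys ps ts

sound : ∀ {C} → Proof C → ∀ v → All (Holdsᵛ v (pool C)) (struct C)
sound ax-empty v = []
sound (ax-id F) v = identity-holds v F ∷ []
sound (mix {p₁ = p₁} {p₂ = p₂} P Q) v =
  ++⁺ (map⁺ (All.map (λ {g} → Holds-map (Member-padʳ p₁ p₂ g)) (sound P v)))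
      (map⁺ (All.map (λ {g} → Holds-map (Member-padˡ p₁ p₂ g)) (sound Q v)))
sound (exch-formula xs F G ys s P) v =
  map⁺ (All.map (λ {g} → Holds-map (Member-swap xs F G ys g)) (sound P v))
sound (exch-group p gs g h hs P) v with ++⁻ gs (sound P v)
... | before , tg ∷ th ∷ after = ++⁺ before (th ∷ tg ∷ after)
sound (weak-group p gs g hs i P) v with ++⁻ gs (sound P v)
... | before , t ∷ after = ++⁺ before (Holds-map (Member-set p g i) t ∷ after)
sound (weak-pool xs F ys s P) v =
  map⁺ (All.map (λ {g} → Holds-map (Member-insert xs F ys g)) (sound P v))
sound (dup-down p gs g hs P) v with ++⁻ gs (sound P v)
... | before , t ∷ after = ++⁺ before (t ∷ t ∷ after)
sound (dup-up p gs g hs P) v with ++⁻ gs (sound P v)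
... | before , t ∷ _ ∷ after = ++⁺ before (t ∷ after)
sound (contr xs F ys s P) v =
  map⁺ (All.map (λ {g} → Holds-merge xs F F F ys g (λ _ → id) (λ _ → id)) (sound P v))
sound (or-intro xs F G ys s P) v =
  map⁺ (All.map (λ {g} → Holds-merge xs F G (F ⋁ G) ys g
                           (λ _ eF → cong (_∨ eval v G) eF)
                           (λ _ eG → trans (cong (eval v F ∨_) eG) (∨-zeroʳ _)))
                (sound P v))
sound (and-intro xs F G ys s ok P) v = Holds-andMerge xs F G ys (AndOK⇒Paired s ok) (sound P v)

soundness : (C : Cirquent) → Provable C → Tautology C
soundness (cirquent k p s) P v = All.map (Holds⇒GroupTrue v p _) (sound P v)

-- Pools and groups as plain lists, so that rules can be applied after
-- reassociating a pool without any arithmetic on the arity index.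
data Derivable (P : List Formula) (S : List (List Bool)) : Set where
  derivation : (p : Vec Formula k) (s : List (Group k)) → toList p ≡ P → map toList s ≡ S →
               Proof (cirquent k p s) → Derivable P S

derivable : ∀ {p : Vec Formula k} {s} → Proof (cirquent k p s) → Derivable (toList p) (map toList s)
derivable P = derivation _ _ refl refl P

subst-pool : ∀ {P P′ S} → P ≡ P′ → Derivable P S → Derivable P′ S
subst-pool refl D = D

toList-injective′ : (p q : Vec T k) → toList p ≡ toList q → p ≡ q
toList-injective′ p q eq = trans (sym (cast-is-id refl p)) (toList-injective refl p q eq)

toList-surjective : (g : List T) → length g ≡ k → Σ (Vec T k) λ g′ → toList g′ ≡ g
toList-surjective g refl = fromList g , toList∘fromList g

toList-fromList-++ : ∀ (P Q : List T) → toList (fromList P ++ᵛ fromList Q) ≡ P ++ Q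
toList-fromList-++ P Q =
  trans (toList-++ (fromList P) (fromList Q)) (cong₂ _++_ (toList∘fromList P) (toList∘fromList Q))

map-toList-natural : ∀ {k k′} {f : Vec T k → Vec T k′} {f′ : List T → List T} →
                     (∀ g → toList (f g) ≡ f′ (toList g)) →
                     ∀ s → map toList (map f s) ≡ map f′ (map toList s)
map-toList-natural eq s = trans (sym (map-∘ s)) (trans (map-cong eq s) (map-∘ s))

reshape : ∀ {P S} → Derivable P S → (p : Vec Formula k) → toList p ≡ P →
          ∃[ s ] map toList s ≡ S × Proof (cirquent k p s)
reshape (derivation p₀ s refl refl prf) p eq
  with trans (sym (length-toList p₀)) (trans (cong length (sym eq)) (length-toList p))
... | refl = s , refl , subst (λ q → Proof (cirquent _ q s)) (toList-injective′ p₀ p (sym eq)) prf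

proof-of : ∀ {P S} {p : Vec Formula k} {s} → Derivable P S → toList p ≡ P → map toList s ≡ S →
           Proof (cirquent k p s)
proof-of D eqp eqs with reshape D _ eqp
... | s′ , eqs′ , prf =
  subst (Proof ∘ cirquent _ _) (map-injective (toList-injective′ _ _) (trans eqs′ (sym eqs))) prf

toList-lengths : ∀ (p : Vec Formula k) (s : List (Group k)) →
                 All (λ g → length g ≡ length (toList p)) (map toList s)
toList-lengths p s = map⁺ (universal (λ g → trans (length-toList g) (sym (length-toList p))) s)

Derivable-lengths : ∀ {P S} → Derivable P S → All (λ g → length g ≡ length P) S
Derivable-lengths (derivation p s refl refl _) = toList-lengths p s

swapAtᴸ : ℕ → List T → List T
swapAtᴸ zero    (x ∷ y ∷ l) = y ∷ x ∷ l
swapAtᴸ (suc m) (x ∷ l)     = x ∷ swapAtᴸ m l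
swapAtᴸ _       l           = l

mergeAtᴸ : ℕ → List Bool → List Bool
mergeAtᴸ zero    (b ∷ c ∷ g) = (b ∨ c) ∷ g
mergeAtᴸ (suc m) (b ∷ g)     = b ∷ mergeAtᴸ m g
mergeAtᴸ _       g           = g

toList-swapAt : ∀ m (g : Group (m + suc (suc n))) → toList (swapAt m g) ≡ swapAtᴸ m (toList g)
toList-swapAt zero    (_ ∷ _ ∷ g) = refl
toList-swapAt (suc m) (b ∷ g)     = cong (b ∷_) (toList-swapAt m g)

toList-mergeAt : ∀ m (g : Group (m + suc (suc n))) → toList (mergeAt m g) ≡ mergeAtᴸ m (toList g)
toList-mergeAt zero    (_ ∷ _ ∷ g) = refl
toList-mergeAt (suc m) (b ∷ g)     = cong (b ∷_) (toList-mergeAt m g)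

swapAtᴸ-++ : ∀ (P : List T) x y Q → swapAtᴸ (length P) (P ++ x ∷ y ∷ Q) ≡ P ++ y ∷ x ∷ Q
swapAtᴸ-++ []      x y Q = refl
swapAtᴸ-++ (z ∷ P) x y Q = cong (z ∷_) (swapAtᴸ-++ P x y Q)

mergeAtᴸ-++ : ∀ (g : List Bool) b c h → mergeAtᴸ (length g) (g ++ b ∷ c ∷ h) ≡ g ++ (b ∨ c) ∷ h
mergeAtᴸ-++ []      b c h = refl
mergeAtᴸ-++ (a ∷ g) b c h = cong (a ∷_) (mergeAtᴸ-++ g b c h)

identityᴸ : ∀ F → Derivable (neg F ∷ F ∷ []) ((true ∷ true ∷ []) ∷ [])
identityᴸ F = derivable (ax-id F)

mixᴸ : ∀ {P₁ P₂ S₁ S₂} → Derivable P₁ S₁ → Derivable P₂ S₂ →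
       Derivable (P₁ ++ P₂)
                 (map (_++ replicate (length P₂) false) S₁ ++ map (replicate (length P₁) false ++_) S₂)
mixᴸ (derivation {k₁} p₁ s₁ refl refl P) (derivation {k₂} p₂ s₂ refl refl Q) =
  derivation _ _ (toList-++ p₁ p₂)
    (trans (map-++ toList (map (_++ᵛ Vec.replicate k₂ false) s₁) _)
           (cong₂ _++_ (map-toList-natural padʳ s₁) (map-toList-natural padˡ s₂)))
    (mix P Q)
  where
  falses : ∀ {k} (p : Vec Formula k) →
           toList (Vec.replicate k false) ≡ replicate (length (toList p)) false
  falses {k} p = trans (toList-replicate k false) (cong (λ n → replicate n false) (sym (length-toList p)))
  padʳ : ∀ g → toList (g ++ᵛ Vec.replicate k₂ false) ≡ toList g ++ replicate (length (toList p₂)) false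
  padʳ g = trans (toList-++ g _) (cong (toList g ++_) (falses p₂))
  padˡ : ∀ g → toList (Vec.replicate k₁ false ++ᵛ g) ≡ replicate (length (toList p₁)) false ++ toList g
  padˡ g = trans (toList-++ _ g) (cong (_++ toList g) (falses p₁))

exchangeᴸ : ∀ P F G Q {S} → Derivable (P ++ F ∷ G ∷ Q) S →
            Derivable (P ++ G ∷ F ∷ Q) (map (swapAtᴸ (length P)) S)
exchangeᴸ P F G Q D with reshape D (fromList P ++ᵛ fromList (F ∷ G ∷ Q)) (toList-fromList-++ P _)
... | s , refl , prf =
  derivation _ _ (toList-fromList-++ P (G ∷ F ∷ Q)) (map-toList-natural (toList-swapAt (length P)) s)
    (exch-formula (fromList P) F G (fromList Q) s prf)

contractionᴸ : ∀ P F Q {S} → Derivable (P ++ F ∷ F ∷ Q) S →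
               Derivable (P ++ F ∷ Q) (map (mergeAtᴸ (length P)) S)
contractionᴸ P F Q D with reshape D (fromList P ++ᵛ fromList (F ∷ F ∷ Q)) (toList-fromList-++ P _)
... | s , refl , prf =
  derivation _ _ (toList-fromList-++ P (F ∷ Q)) (map-toList-natural (toList-mergeAt (length P)) s)
    (contr (fromList P) F (fromList Q) s prf)

pairAt-++ : ∀ (g : Group m) b c (h : Group n) → pairAt m (g ++ᵛ b ∷ c ∷ h) ≡ (b , c)
pairAt-++ []      b c h = refl
pairAt-++ (_ ∷ g) b c h = pairAt-++ g b c h

mergeAt-++ : ∀ (g : Group m) b c (h : Group n) → mergeAt m (g ++ᵛ b ∷ c ∷ h) ≡ g ++ᵛ (b ∨ c) ∷ h
mergeAt-++ []      b c h = refl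
mergeAt-++ (a ∷ g) b c h = cong (a ∷_) (mergeAt-++ g b c h)

insertAt-++ : ∀ (g : Group m) (h : Group n) → insertAt m (g ++ᵛ h) ≡ g ++ᵛ false ∷ h
insertAt-++ []      h = refl
insertAt-++ (a ∷ g) h = cong (a ∷_) (insertAt-++ g h)

subst-group : ∀ {p : Vec Formula k} {g g′} → g ≡ g′ →
              Proof (cirquent k p (g ∷ [])) → Proof (cirquent k p (g′ ∷ []))
subst-group refl P = P

AndOK-pair : ∀ m (g h : Group (m + suc (suc n))) →
             pairAt m g ≡ (true , false) → pairAt m h ≡ (false , true) → AndOK m (g ∷ h ∷ [])
AndOK-pair m g h eg eh = disjoint , followed , preceded
  where
  disjoint : (i : Fin 2) →
             ¬ (inF m (lookupᴸ (g ∷ h ∷ []) i) ≡ true × inG m (lookupᴸ (g ∷ h ∷ []) i) ≡ true)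
  disjoint fzero        (_ , G∈g) = false≢true (trans (sym (cong proj₂ eg)) G∈g)
  disjoint (fsuc fzero) (F∈h , _) = false≢true (trans (sym (cong proj₁ eh)) F∈h)
  followed : (i : Fin 2) → inF m (lookupᴸ (g ∷ h ∷ []) i) ≡ true →
             Σ (Fin 2) λ j → toℕ j ≡ suc (toℕ i) × inG m (lookupᴸ (g ∷ h ∷ []) j) ≡ true
  followed fzero        _   = fsuc fzero , refl , cong proj₂ eh
  followed (fsuc fzero) F∈h = ⊥-elim (false≢true (trans (sym (cong proj₁ eh)) F∈h))
  preceded : (j : Fin 2) → inG m (lookupᴸ (g ∷ h ∷ []) j) ≡ true →
             Σ (Fin 2) λ i → toℕ j ≡ suc (toℕ i) × inF m (lookupᴸ (g ∷ h ∷ []) i) ≡ true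
  preceded fzero        G∈g = ⊥-elim (false≢true (trans (sym (cong proj₂ eg)) G∈g))
  preceded (fsuc fzero) _   = fzero , refl , cong proj₁ eg

andMerge-split : ∀ (g : Group m) (h : Group n) →
                 andMerge m ((g ++ᵛ true ∷ false ∷ h) ∷ (g ++ᵛ false ∷ true ∷ h) ∷ [])
                 ≡ (g ++ᵛ true ∷ h) ∷ []
andMerge-split {m} g h rewrite cong proj₁ (pairAt-++ g true false h) = cong (_∷ []) (begin
    mergeAt m (Vec.zipWith _∨_ (g ++ᵛ true ∷ false ∷ h) (g ++ᵛ false ∷ true ∷ h))
  ≡⟨ cong (mergeAt m) (zipWith-++ _∨_ g _ g _) ⟩
    mergeAt m (Vec.zipWith _∨_ g g ++ᵛ true ∷ true ∷ Vec.zipWith _∨_ h h)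
  ≡⟨ mergeAt-++ (Vec.zipWith _∨_ g g) true true _ ⟩
    Vec.zipWith _∨_ g g ++ᵛ true ∷ Vec.zipWith _∨_ h h
  ≡⟨ cong₂ (λ g′ h′ → g′ ++ᵛ true ∷ h′) (zipWith-idem ∨-idem g) (zipWith-idem ∨-idem h) ⟩
    g ++ᵛ true ∷ h ∎)
  where open ≡-Reasoning

weaken-single : ∀ (xs : Vec Formula m) F (ys : Vec Formula n) (g : Group m) (h : Group n) b →
                Proof (cirquent _ (xs ++ᵛ ys) ((g ++ᵛ h) ∷ [])) →
                Proof (cirquent _ (xs ++ᵛ F ∷ ys) ((g ++ᵛ b ∷ h) ∷ []))
weaken-single xs F ys g h false P = subst-group (insertAt-++ g h) (weak-pool xs F ys _ P)
weaken-single {m} xs F ys g h true P =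
  subst-group ([]≔-++-↑ʳ g (false ∷ h) fzero)
    (weak-group _ [] _ [] (m ↑ʳ fzero) (weaken-single xs F ys g h false P))

∨-intro-single : ∀ (xs : Vec Formula m) F G (ys : Vec Formula n) (g : Group m) (h : Group n) →
                 Proof (cirquent _ (xs ++ᵛ F ∷ G ∷ ys) ((g ++ᵛ true ∷ true ∷ h) ∷ [])) →
                 Proof (cirquent _ (xs ++ᵛ (F ⋁ G) ∷ ys) ((g ++ᵛ true ∷ h) ∷ []))
∨-intro-single xs F G ys g h P = subst-group (mergeAt-++ g true true h) (or-intro xs F G ys _ P)

∧-intro-single : ∀ (xs : Vec Formula m) F G (ys : Vec Formula n) (g : Group m) (h : Group n) →
                 Proof (cirquent _ (xs ++ᵛ F ∷ G ∷ ys)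
                                   ((g ++ᵛ true ∷ false ∷ h) ∷ (g ++ᵛ false ∷ true ∷ h) ∷ [])) →
                 Proof (cirquent _ (xs ++ᵛ (F ⋀ G) ∷ ys) ((g ++ᵛ true ∷ h) ∷ []))
∧-intro-single {m} xs F G ys g h P =
  subst (Proof ∘ cirquent _ _) (andMerge-split g h)
    (and-intro xs F G ys _ (AndOK-pair m _ _ (pairAt-++ g true false h) (pairAt-++ g false true h)) P)

weakenᴸ : ∀ {P Q g h} F b → length g ≡ length P → length h ≡ length Q →
          Derivable (P ++ Q) ((g ++ h) ∷ []) → Derivable (P ++ F ∷ Q) ((g ++ b ∷ h) ∷ [])
weakenᴸ {P} {Q} {g} {h} F b lg lh D with toList-surjective g lg | toList-surjective h lh
... | g′ , refl | h′ , refl =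
  derivation _ _ (toList-fromList-++ P (F ∷ Q)) (cong (_∷ []) (toList-++ g′ (b ∷ h′)))
    (weaken-single (fromList P) F (fromList Q) g′ h′ b
      (proof-of D (toList-fromList-++ P Q) (cong (_∷ []) (toList-++ g′ h′))))

∨-introᴸ : ∀ {P Q g h F G} → length g ≡ length P → length h ≡ length Q →
           Derivable (P ++ F ∷ G ∷ Q) ((g ++ true ∷ true ∷ h) ∷ []) →
           Derivable (P ++ (F ⋁ G) ∷ Q) ((g ++ true ∷ h) ∷ [])
∨-introᴸ {P} {Q} {g} {h} {F} {G} lg lh D with toList-surjective g lg | toList-surjective h lh
... | g′ , refl | h′ , refl =
  derivation _ _ (toList-fromList-++ P ((F ⋁ G) ∷ Q)) (cong (_∷ []) (toList-++ g′ (true ∷ h′)))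
    (∨-intro-single (fromList P) F G (fromList Q) g′ h′
      (proof-of D (toList-fromList-++ P (F ∷ G ∷ Q)) (cong (_∷ []) (toList-++ g′ (true ∷ true ∷ h′)))))

∧-introᴸ : ∀ {P Q g h F G} → length g ≡ length P → length h ≡ length Q →
           Derivable (P ++ F ∷ G ∷ Q) ((g ++ true ∷ false ∷ h) ∷ (g ++ false ∷ true ∷ h) ∷ []) →
           Derivable (P ++ (F ⋀ G) ∷ Q) ((g ++ true ∷ h) ∷ [])
∧-introᴸ {P} {Q} {g} {h} {F} {G} lg lh D with toList-surjective g lg | toList-surjective h lh
... | g′ , refl | h′ , refl =
  derivation _ _ (toList-fromList-++ P ((F ⋀ G) ∷ Q)) (cong (_∷ []) (toList-++ g′ (true ∷ h′)))
    (∧-intro-single (fromList P) F G (fromList Q) g′ h′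
      (proof-of D (toList-fromList-++ P (F ∷ G ∷ Q))
        (cong₂ (λ g₁ g₂ → g₁ ∷ g₂ ∷ [])
               (toList-++ g′ (true ∷ false ∷ h′)) (toList-++ g′ (false ∷ true ∷ h′)))))

-- Combining two structures over one pool

moveLeftᴸ : ℕ → ℕ → List T → List T
moveLeftᴸ o zero    = id
moveLeftᴸ o (suc m) = swapAtᴸ o ∘ moveLeftᴸ (suc o) m

length-snoc : ∀ (P : List T) x → length (P ++ x ∷ []) ≡ suc (length P)
length-snoc P x = trans (length-++ P) (+-comm (length P) 1)

moveLeftᴸ-++ : ∀ (P Q : List T) x R →
               moveLeftᴸ (length P) (length Q) (P ++ Q ++ x ∷ R) ≡ P ++ x ∷ Q ++ R
moveLeftᴸ-++ P []      x R = refl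
moveLeftᴸ-++ P (y ∷ Q) x R with moveLeftᴸ-++ (P ++ y ∷ []) Q x R
... | ih rewrite length-snoc P y | ++-assoc P (y ∷ []) (Q ++ x ∷ R) | ++-assoc P (y ∷ []) (x ∷ Q ++ R) =
  trans (cong (swapAtᴸ (length P)) ih) (swapAtᴸ-++ P y x (Q ++ R))

move-left : ∀ P Q x R {S} → Derivable (P ++ Q ++ x ∷ R) S →
            Derivable (P ++ x ∷ Q ++ R) (map (moveLeftᴸ (length P) (length Q)) S)
move-left P []      x R {S} D = subst (Derivable _) (sym (map-id S)) D
move-left P (y ∷ Q) x R {S} D
  with move-left (P ++ y ∷ []) Q x R (subst-pool (sym (++-assoc P (y ∷ []) _)) D)
... | D′ rewrite length-snoc P y | ++-assoc P (y ∷ []) (x ∷ Q ++ R) =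
  subst (Derivable _) (sym (map-∘ S)) (exchangeᴸ P y x (Q ++ R) D′)

-- A group over a pool Q ++ P ++ P, cut into its parts over the three blocks.
Triple : Set
Triple = List Bool × List Bool × List Bool

joined merged : Triple → List Bool
joined (a , b , c) = a ++ b ++ c
merged (a , b , c) = a ++ zipWith _∨_ b c

Fits : List Formula → List Formula → Triple → Set
Fits Q P (a , b , c) = length a ≡ length Q × length b ≡ length P × length c ≡ length P

contract-step : Triple → Triple
contract-step (a , b ∷ b′ , c ∷ c′) = a ++ (b ∨ c) ∷ [] , b′ , c′
contract-step t                     = t    -- excluded by Fits

Fits-step : ∀ {Q X P} t → Fits Q (X ∷ P) t → Fits (Q ++ X ∷ []) P (contract-step t)
Fits-step {Q} {X} (a , b ∷ b′ , c ∷ c′) (la , lb , lc) =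
  trans (length-snoc a _) (trans (cong suc la) (sym (length-snoc Q X))) , suc-injective lb , suc-injective lc

merged-step : ∀ t → merged (contract-step t) ≡ merged t
merged-step (a , b ∷ b′ , c ∷ c′) = ++-assoc a ((b ∨ c) ∷ []) _
merged-step (a , []     , c)      = refl
merged-step (a , _ ∷ _  , [])     = refl

joined-step : ∀ {Q X P} t → Fits Q (X ∷ P) t →
              mergeAtᴸ (length Q) (moveLeftᴸ (length (Q ++ X ∷ [])) (length P) (joined t))
              ≡ joined (contract-step t)
joined-step {Q} {X} {P} (a , b ∷ b′ , c ∷ c′) (la , lb , _)
  rewrite length-snoc Q X | sym la | sym (suc-injective lb) | sym (length-snoc a b) = begin
    mergeAtᴸ (length a) (moveLeftᴸ (length (a ++ b ∷ [])) (length b′) (a ++ b ∷ b′ ++ c ∷ c′))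
  ≡⟨ cong (mergeAtᴸ (length a) ∘ moveLeftᴸ (length (a ++ b ∷ [])) (length b′))
          (sym (++-assoc a (b ∷ []) _)) ⟩
    mergeAtᴸ (length a) (moveLeftᴸ (length (a ++ b ∷ [])) (length b′) ((a ++ b ∷ []) ++ b′ ++ c ∷ c′))
  ≡⟨ cong (mergeAtᴸ (length a))
          (trans (moveLeftᴸ-++ (a ++ b ∷ []) b′ c c′) (++-assoc a (b ∷ []) _)) ⟩
    mergeAtᴸ (length a) (a ++ b ∷ c ∷ b′ ++ c′)
  ≡⟨ mergeAtᴸ-++ a b c _ ⟩
    a ++ (b ∨ c) ∷ b′ ++ c′
  ≡⟨ sym (++-assoc a ((b ∨ c) ∷ []) _) ⟩
    (a ++ (b ∨ c) ∷ []) ++ b′ ++ c′ ∎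
  where open ≡-Reasoning

contract-copies : ∀ Q P (T : List Triple) → All (Fits Q P) T →
                  Derivable (Q ++ P ++ P) (map joined T) → Derivable (Q ++ P) (map merged T)
contract-copies Q [] T fits D =
  subst (Derivable _) (map-cong-local (All.map (λ {t} → joined≡merged {t}) fits)) D
  where
  joined≡merged : ∀ {t} → Fits Q [] t → joined t ≡ merged t
  joined≡merged {_ , [] , []} _ = refl
contract-copies Q (X ∷ P) T fits D =
  subst₂ Derivable (++-assoc Q (X ∷ []) P) (trans (sym (map-∘ T)) (map-cong merged-step T))
    (contract-copies (Q ++ X ∷ []) P (map contract-step T)
                     (map⁺ (All.map (λ {t} → Fits-step {Q} {X} {P} t) fits))
      (subst₂ Derivable (sym (++-assoc Q (X ∷ []) (P ++ P))) structure
        (contractionᴸ Q X (P ++ P)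
          (subst-pool (++-assoc Q (X ∷ []) (X ∷ P ++ P))
            (move-left (Q ++ X ∷ []) P X P
              (subst-pool (sym (++-assoc Q (X ∷ []) (P ++ X ∷ P))) D))))))
  where
  structure : map (mergeAtᴸ (length Q)) (map (moveLeftᴸ (length (Q ++ X ∷ [])) (length P)) (map joined T))
              ≡ map joined (map contract-step T)
  structure = begin
      map (mergeAtᴸ (length Q)) (map (moveLeftᴸ (length (Q ++ X ∷ [])) (length P)) (map joined T))
    ≡⟨ sym (trans (map-∘ T) (map-∘ (map joined T))) ⟩
      map (mergeAtᴸ (length Q) ∘ moveLeftᴸ (length (Q ++ X ∷ [])) (length P) ∘ joined) T
    ≡⟨ map-cong-local (All.map (λ {t} → joined-step {Q} {X} {P} t) fits) ⟩
      map (joined ∘ contract-step) T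
    ≡⟨ map-∘ T ⟩
      map joined (map contract-step T) ∎
    where open ≡-Reasoning

∨-falsesʳ : ∀ {g n} → length g ≡ n → zipWith _∨_ g (replicate n false) ≡ g
∨-falsesʳ {[]}    refl = refl
∨-falsesʳ {b ∷ g} refl = cong₂ _∷_ (∨-identityʳ b) (∨-falsesʳ refl)

∨-falsesˡ : ∀ {g n} → length g ≡ n → zipWith _∨_ (replicate n false) g ≡ g
∨-falsesˡ {[]}    refl = refl
∨-falsesˡ {b ∷ g} refl = cong (b ∷_) (∨-falsesˡ refl)

combine : ∀ {P S₁ S₂} → Derivable P S₁ → Derivable P S₂ → Derivable P (S₁ ++ S₂)
combine {P} {S₁} {S₂} D₁ D₂ =
  subst (Derivable P) unpad
    (contract-copies [] P padded fits (subst (Derivable (P ++ P)) pad (mixᴸ D₁ D₂)))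
  where
  falses : List Bool
  falses = replicate (length P) false
  left right : List Bool → Triple
  left  g = [] , g , falses
  right g = [] , falses , g
  padded : List Triple
  padded = map left S₁ ++ map right S₂
  pad : map (_++ falses) S₁ ++ map (falses ++_) S₂ ≡ map joined padded
  pad = sym (trans (map-++ joined (map left S₁) (map right S₂))
                   (cong₂ _++_ (sym (map-∘ {g = joined} {left} S₁)) (sym (map-∘ {g = joined} {right} S₂))))
  fits : All (Fits [] P) padded
  fits = ++⁺ (map⁺ (All.map (λ l → refl , l , length-replicate _) (Derivable-lengths D₁)))
             (map⁺ (All.map (λ l → refl , length-replicate _ , l) (Derivable-lengths D₂)))
  unpad : map merged padded ≡ S₁ ++ S₂
  unpad = trans (map-++ merged (map left S₁) (map right S₂))
    (cong₂ _++_
      (trans (sym (map-∘ {g = merged} {left} S₁))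
             (map-id-local (All.map ∨-falsesʳ (Derivable-lengths D₁))))
      (trans (sym (map-∘ {g = merged} {right} S₂))
             (map-id-local (All.map ∨-falsesˡ (Derivable-lengths D₂)))))

-- Completeness

data Literal : Formula → Set where
  atom  : ∀ a → Literal (atom a)
  natom : ∀ a → Literal (natom a)

data MemberView : List Formula → List Bool → Set where
  literals : ∀ {P g} → (∀ {F} → Member F P g → Literal F) → MemberView P g
  ∧-member : ∀ P g F G Q h → length g ≡ length P → length h ≡ length Q →
             MemberView (P ++ (F ⋀ G) ∷ Q) (g ++ true ∷ h)
  ∨-member : ∀ P g F G Q h → length g ≡ length P → length h ≡ length Q →
             MemberView (P ++ (F ⋁ G) ∷ Q) (g ++ true ∷ h)

cons-view : ∀ {F b P g} → (b ≡ true → Literal F) → MemberView P g → MemberView (F ∷ P) (b ∷ g)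
cons-view lit (literals lits) = literals λ { here → lit refl ; (there m) → lits m }
cons-view {F} {b} lit (∧-member P g G H Q h lg lh) = ∧-member (F ∷ P) (b ∷ g) G H Q h (cong suc lg) lh
cons-view {F} {b} lit (∨-member P g G H Q h lg lh) = ∨-member (F ∷ P) (b ∷ g) G H Q h (cong suc lg) lh

memberView : ∀ P g → length g ≡ length P → MemberView P g
memberView []            []          _ = literals λ ()
memberView (atom a ∷ P)  (_ ∷ g)     l = cons-view (λ _ → atom a) (memberView P g (suc-injective l))
memberView (natom a ∷ P) (_ ∷ g)     l = cons-view (λ _ → natom a) (memberView P g (suc-injective l))
memberView ((F ⋀ G) ∷ P) (true ∷ g)  l = ∧-member [] [] F G P g refl (suc-injective l)
memberView ((F ⋁ G) ∷ P) (true ∷ g)  l = ∨-member [] [] F G P g refl (suc-injective l)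
memberView (F ∷ P)       (false ∷ g) l = cons-view (λ ()) (memberView P g (suc-injective l))

connectives : Formula → ℕ
connectives (atom _)  = 0
connectives (natom _) = 0
connectives (F ⋀ G)   = suc (connectives F + connectives G)
connectives (F ⋁ G)   = suc (connectives F + connectives G)

size : List Formula → ℕ
size = sum ∘ map connectives

size-decreases : ∀ P Q {F G X} → connectives X ≡ suc (connectives F + connectives G) →
                 size (P ++ F ∷ G ∷ Q) < size (P ++ X ∷ Q)
size-decreases []      Q {F} {G} eq rewrite eq =
  s≤s (≤-reflexive (sym (+-assoc (connectives F) (connectives G) (size Q))))
size-decreases (Y ∷ P) Q eq = +-monoʳ-< (connectives Y) (size-decreases P Q eq)

length-++-≡ : ∀ {A B : Set} (g : List A) {h} (P : List B) {Q} →
              length g ≡ length P → length h ≡ length Q → length (g ++ h) ≡ length (P ++ Q)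
length-++-≡ g P lg lh = trans (length-++ g) (trans (cong₂ _+_ lg lh) (sym (length-++ P)))

∨-witness : ∀ v F G → eval v (F ⋁ G) ≡ true → Holds v (F ∷ G ∷ []) (true ∷ true ∷ [])
∨-witness v F G e with eval v F in eF
... | true  = F , here , eF
... | false = G , there here , e

∧-witnessˡ : ∀ v F G → eval v (F ⋀ G) ≡ true → Holds v (F ∷ G ∷ []) (true ∷ false ∷ [])
∧-witnessˡ v F G e with eval v F in eF
... | true = F , here , eF
∧-witnessˡ v F G () | false

∧-witnessʳ : ∀ v F G → eval v (F ⋀ G) ≡ true → Holds v (F ∷ G ∷ []) (false ∷ true ∷ [])
∧-witnessʳ v F G e with eval v G in eG
... | true  = G , there here , eG
... | false = ⊥-elim (false≢true (trans (sym (∧-zeroʳ (eval v F))) e))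

Holds-split : ∀ {v P Q g h X F G b c} → length g ≡ length P →
              (eval v X ≡ true → Holds v (F ∷ G ∷ []) (b ∷ c ∷ [])) →
              Holds v (P ++ X ∷ Q) (g ++ true ∷ h) → Holds v (P ++ F ∷ G ∷ Q) (g ++ b ∷ c ∷ h)
Holds-split {P = []}    {g = []}    _ w (_ , here , e) with w e
... | K , here , e′       = K , here , e′
... | K , there here , e′ = K , there here , e′
Holds-split {P = []}    {g = []}    _ w (K , there m , e) = K , there (there m) , e
Holds-split {P = Y ∷ P} {g = _ ∷ g} _ w (_ , here , e)    = Y , here , e
Holds-split {P = _ ∷ P} {g = _ ∷ g} l w (K , there m , e) =
  Holds-there (Holds-split (suc-injective l) w (K , m , e))

_≟natom_ : ∀ (F : Formula) a → Dec (F ≡ natom a)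
atom _  ≟natom a = no λ ()
natom b ≟natom a = map′ (cong natom) (λ { refl → refl }) (b ≟ a)
(_ ⋀ _) ≟natom a = no λ ()
(_ ⋁ _) ≟natom a = no λ ()

natom-member? : ∀ a P g → Dec (Member (natom a) P g)
natom-member? a []      _       = no λ ()
natom-member? a (_ ∷ _) []      = no λ ()
natom-member? a (F ∷ P) (b ∷ g) with natom-member? a P g | b | F ≟natom a
... | yes m | _     | _        = yes (there m)
... | no ¬m | true  | yes refl = yes here
... | no ¬m | true  | no F≢    = no λ { here → F≢ refl ; (there m) → ¬m m }
... | no ¬m | false | _        = no λ { (there m) → ¬m m }

-- Every literal member of g is false here, unless g contains both p and ¬p.
refuter : List Formula → List Bool → Model
refuter P g a = does (natom-member? a P g)

complementary-pair : ∀ {P g} → (∀ {F} → Member F P g → Literal F) → (∀ v → Holds v P g) →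
                     ∃[ a ] Member (atom a) P g × Member (natom a) P g
complementary-pair {P} {g} lits valid with valid (refuter P g)
... | F , m , true-F with lits m
...   | atom a with natom-member? a P g
...     | yes m′ = a , m , m′
...     | no _   = ⊥-elim (false≢true true-F)
complementary-pair {P} {g} lits valid | F , m , true-F | natom a with natom-member? a P g
...     | yes _ = ⊥-elim (false≢true true-F)
...     | no ¬m = ⊥-elim (¬m m)

identity-weakened : ∀ F P g → length g ≡ length P →
                    Derivable (neg F ∷ F ∷ P) ((true ∷ true ∷ g) ∷ [])
identity-weakened F []      []      _ = identityᴸ F
identity-weakened F (G ∷ P) (b ∷ g) l =
  weakenᴸ {P = neg F ∷ F ∷ []} {g = true ∷ true ∷ []} G b refl (suc-injective l)
    (identity-weakened F P g (suc-injective l))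

complement-weakened : ∀ {F P g} → Member F P g → length g ≡ length P →
                      Derivable (neg F ∷ P) ((true ∷ g) ∷ [])
complement-weakened {F} (here {P} {g})    l = identity-weakened F P g (suc-injective l)
complement-weakened {F} (there {H} {b} m) l =
  weakenᴸ {P = neg F ∷ []} {g = true ∷ []} H b refl (suc-injective l)
    (complement-weakened m (suc-injective l))

complementary-derivable : ∀ {a P g} → Member (atom a) P g → Member (natom a) P g → length g ≡ length P →
                          Derivable P (g ∷ [])
complementary-derivable here              (there m)  l = complement-weakened m (suc-injective l)
complementary-derivable (there m)         here       l = complement-weakened m (suc-injective l)
complementary-derivable (there {H} {b} m) (there m′) l =
  weakenᴸ {P = []} {g = []} H b refl (suc-injective l) (complementary-derivable m m′ (suc-injective l))

complete-group : ∀ P g → Acc _<_ (size P) → length g ≡ length P → (∀ v → Holds v P g) →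
                 Derivable P (g ∷ [])
complete-group P g _ l valid with memberView P g l
... | literals lits with complementary-pair lits valid
...   | _ , m , m′ = complementary-derivable m m′ l
complete-group _ _ (acc smaller) _ valid | ∨-member P g F G Q h lg lh =
  ∨-introᴸ lg lh (complete-group _ _ (smaller (size-decreases P Q refl))
                                 (length-++-≡ g P lg (cong (suc ∘ suc) lh))
                                 (λ v → Holds-split lg (∨-witness v F G) (valid v)))
complete-group _ _ (acc smaller) _ valid | ∧-member P g F G Q h lg lh =
  ∧-introᴸ lg lh (combine (split ∧-witnessˡ) (split ∧-witnessʳ))
  where
  split : ∀ {b c} → (∀ v X Y → eval v (X ⋀ Y) ≡ true → Holds v (X ∷ Y ∷ []) (b ∷ c ∷ [])) →
          Derivable (P ++ F ∷ G ∷ Q) ((g ++ b ∷ c ∷ h) ∷ [])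
  split witness =
    complete-group _ _ (smaller (size-decreases P Q refl)) (length-++-≡ g P lg (cong (suc ∘ suc) lh))
                   (λ v → Holds-split lg (witness v F G) (valid v))

empty-structure : (p : Vec Formula k) → Proof (cirquent k p [])
empty-structure []      = ax-empty
empty-structure (F ∷ p) = weak-pool [] F p [] (empty-structure p)

complete : ∀ P S → All (λ g → length g ≡ length P) S → (∀ v → All (Holds v P) S) → Derivable P S
complete P []      _        _     =
  derivation (fromList P) [] (toList∘fromList P) refl (empty-structure (fromList P))
complete P (g ∷ S) (l ∷ ls) valid =
  combine (complete-group P g (<-wellFounded (size P)) l (All.head ∘ valid))
          (complete P S ls (All.tail ∘ valid))

completeness : (C : Cirquent) → Tautology C → Provable C
completeness (cirquent k p s) taut =
  proof-of (complete (toList p) (map toList s) (toList-lengths p s)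
                     (λ v → map⁺ (All.map (GroupTrue⇒Holds v p _) (taut v))))
           refl refl

theorem6p3 : (C : Cirquent) → (Provable C → Tautology C) × (Tautology C → Provable C)
theorem6p3 C = soundness C , completeness C
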